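{- Let $\bar\Gamma$ be a connected undirected simple graph that contains an induced subgraph isomorphic to $E_6$. If $\bar\Gamma$ has at least $9$ vertices, then $\bar\Gamma$ is not BM-equivalent to any Dynkin graph.
   Context: Basic move: for adjacent vertices $a,c$, $\phi_{c,a}$ toggles adjacency between $c$ and every vertex $x\ne c$ adjacent to $a$, leaving other edges unchanged. BM-equivalence is generated by basic moves. Dynkin graphs are the trees $A_n$ (path), $D_n$ (path with two leaves at one end), $E_6,E_7,E_8$. The last three have a branch vertex with arms of lengths $(1,2,2),(1,2,3),(1,2,4)$. -}

module Defs where

open import Data.Bool using (Bool; true; false; _∧_; _∨_; not; if_then_else_)
open import Data.Nat using (ℕ; zero; suc; _+_; _≡ᵇ_)
open import Data.Fin using (Fin; toℕ; _≟_)
open import Data.Product using (Σ; Σ-syntax; _×_)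
open import Function.Bundles using (_↔_; Inverse)
open import Function.Definitions using (Injective)
open import Relation.Nullary using (does)
open import Relation.Binary.PropositionalEquality using (_≡_)
open import Relation.Binary.Construct.Closure.ReflexiveTransitive using (Star)
open import Relation.Binary.Construct.Closure.Equivalence using (EqClosure)

record Graph (n : ℕ) : Set where
  field
    adj    : Fin n → Fin n → Bool
    sym    : ∀ i j → adj i j ≡ adj j i
    irrefl : ∀ i → adj i i ≡ false
open Graph public

Connected : ∀ {n} → Graph n → Set
Connected G = ∀ i j → Star (λ x y → adj G x y ≡ true) i j

-- Basic move φ_{c,a}: toggles the edge {c,x} for every x ≠ c adjacent to a.

φ : ∀ {n} → Fin n → Fin n → (Fin n → Fin n → Bool) → Fin n → Fin n → Bool
φ c a A x y =
  if (does (x ≟ c) ∧ not (does (y ≟ c)) ∧ A a y)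
     ∨ (does (y ≟ c) ∧ not (does (x ≟ c)) ∧ A a x)
  then not (A x y) else A x y

BasicMove : ∀ {n} → Graph n → Graph n → Set
BasicMove {n} G H =
  Σ[ c ∈ Fin n ] Σ[ a ∈ Fin n ]
    (adj G c a ≡ true × (∀ x y → adj H x y ≡ φ c a (adj G) x y))

BMEquivalent : ∀ {n} → Graph n → Graph n → Set
BMEquivalent = EqClosure BasicMove

pathAdjℕ : ℕ → ℕ → Bool
pathAdjℕ i j = (suc i ≡ᵇ j) ∨ (suc j ≡ᵇ i)

-- path 0 - ... - (p-1), plus extra vertex p attached to vertex b
pathPlusℕ : ℕ → ℕ → ℕ → ℕ → Bool
pathPlusℕ p b i j =
  (pathAdjℕ i j ∧ not (i ≡ᵇ p) ∧ not (j ≡ᵇ p))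
  ∨ ((i ≡ᵇ p) ∧ (j ≡ᵇ b)) ∨ ((j ≡ᵇ p) ∧ (i ≡ᵇ b))

data DynkinType : ℕ → Set where
  A  : (k : ℕ) → DynkinType (suc k)
  D  : (k : ℕ) → DynkinType (4 + k)
  E6 : DynkinType 6
  E7 : DynkinType 7
  E8 : DynkinType 8

dynkinAdjℕ : ∀ {n} → DynkinType n → ℕ → ℕ → Bool
dynkinAdjℕ (A k) = pathAdjℕ
dynkinAdjℕ (D k) = pathPlusℕ (3 + k) (1 + k)   -- two leaves 2+k, 3+k at vertex 1+k
dynkinAdjℕ E6    = pathPlusℕ 5 2               -- arms (1,2,2) at vertex 2
dynkinAdjℕ E7    = pathPlusℕ 6 2               -- arms (1,2,3)
dynkinAdjℕ E8    = pathPlusℕ 7 2               -- arms (1,2,4)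

dynkinAdj : ∀ {n} → DynkinType n → Fin n → Fin n → Bool
dynkinAdj t i j = dynkinAdjℕ t (toℕ i) (toℕ j)

IsDynkin : ∀ {n} → Graph n → Set
IsDynkin {n} G =
  Σ[ t ∈ DynkinType n ] Σ[ σ ∈ Fin n ↔ Fin n ]
    (∀ i j → adj G (Inverse.to σ i) (Inverse.to σ j) ≡ dynkinAdj t i j)

HasInducedE6 : ∀ {n} → Graph n → Set
HasInducedE6 {n} G =
  Σ[ f ∈ (Fin 6 → Fin n) ]
    (Injective _≡_ _≡_ f × (∀ i j → adj G (f i) (f j) ≡ dynkinAdj E6 i j))

-- Call a graph realisable when its vertices carry linearly independent integer vectors, the
-- roots, of norm 2 whose inner products are ±1 along edges and 0 between distinct non-adjacent
-- vertices: the graph of a positive definite quasi-Cartan matrix. The basic move φ_{c,a} is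
-- realised by reflecting r_c in r_a, r_c ↦ r_c − (r_c·r_a) r_a. On a triangle {c, a, j}
-- positive definiteness forces r_c·r_j = (r_c·r_a)(r_a·r_j), so the new inner product r′_c·r_j
-- vanishes exactly when φ_{c,a} deletes the edge {c, j}. Hence realisability is invariant under
-- BM-equivalence, and the Dynkin graphs with at least 9 vertices, A_n and D_n, are realisable by
-- their root systems.
--
-- A realisable graph has no induced star K_{1,4}, as 2r₀ − Σ (r₀·r_j) r_j would be isotropic.
-- Let E₆ be induced in a connected realisable graph with at least 9 vertices. Some vertex v
-- outside it has a neighbour in it, and a move φ_{v,x} at a neighbour x of v in E₆ keeps E₆ and
-- adds the neighbourhood of x to that of v modulo 2. A strategy, checked by computation, moves
-- every nonzero neighbourhood pattern of v either to the one extending E₆ to E₇ or to one that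
-- creates an induced K_{1,4}. The same holds for E₇, and for E₈ only the stars remain.

{-# OPTIONS --safe #-}
module Submission where

open import Data.Bool using (Bool; true; false; _xor_; if_then_else_)
open import Data.Bool.Properties using (xor-assoc; xor-same; ∧-zeroʳ; ∨-identityʳ) renaming (_≟_ to _≟ᵇ_)
open import Data.Empty using (⊥-elim)
open import Data.Fin using (Fin; zero; suc; #_)
open import Data.Fin.Properties using (_≟_; suc-injective; all?; any?; ¬∀⟶∃¬; injective⇒≤)
open import Data.Fin.Subset using (Subset; ⁅_⁆; _∪_; Nonempty)
open import Data.Fin.Subset.Properties using (nonempty?; anySubset?)
open import Data.Integer using (ℤ; 0ℤ; 1ℤ; -1ℤ; +_; +[1+_]; -[1+_]; -_; _+_; _*_; +≤+)
import Data.Integer as ℤ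
open import Data.Integer.Properties
  using (+-*-semiring; *-comm; *-assoc; *-zeroˡ; *-zeroʳ; *-identityˡ; *-identityʳ;
         +-identityˡ; +-identityʳ; +-mono-≤; i*j≡0⇒i≡0∨j≡0)
  renaming (_≟_ to _≟ℤ_)
open import Data.Integer.Tactic.RingSolver using (solve-∀)
open import Data.Nat using (ℕ; zero; suc; z≤n; _≤_; _<_; _/_; _%_)
import Data.Nat as ℕ
open import Data.Nat.DivMod using (_mod_)
open import Data.Nat.Properties using (_≤?_; <⇒≱; ≤-trans; m≤n+m)
open import Data.Product using (Σ-syntax; _×_; _,_; proj₁; proj₂)
open import Data.Sum using (_⊎_; inj₁; inj₂; [_,_]′)
open import Data.Vec using (lookup; tabulate; foldr′)
open import Data.Vec.Functional using (Vector; []; _∷_)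
open import Data.Vec.Properties using (lookup-replicate; lookup∘tabulate; lookup⇒[]=)
  renaming (≡-dec to ≡-decᵛ)
open import Function using (_∘_; id; case_of_)
open import Function.Bundles using (mk⇔; _↔_; Inverse)
open import Function.Definitions using (Injective)
open import Relation.Binary.Construct.Closure.ReflexiveTransitive using (Star; ε; _◅_; kleisliStar; reverse)
open import Relation.Binary.Construct.Closure.Symmetric using (fwd; bwd)
open import Relation.Binary.PropositionalEquality
open import Relation.Nullary using (¬_; yes; no; does)
open import Relation.Nullary.Decidable
  using (Dec; True; map′; toSum; ¬?; _⊎-dec_; _×-dec_; _→-dec_; toWitness; from-no;
         dec-true; dec-false; does-⇔; decidable-stable)
open import Relation.Unary using (Decidable)

open import Defs renaming (sym to adj-sym; irrefl to adj-irrefl)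

open import Algebra.Properties.Semiring.Sum +-*-semiring
  using (sum; sum-syntax; sum-cong-≋; sum-replicate-zero; ∑-comm; ∑-distrib-+; *-distribˡ-sum; *-distribʳ-sum)

private variable
  k m n t : ℕ

-- Integer vectors

infix 7 _∙_

_∙_ : Vector ℤ m → Vector ℤ m → ℤ
_∙_ {m} u v = ∑[ t < m ] (u t * v t)

∙-comm : (u v : Vector ℤ m) → u ∙ v ≡ v ∙ u
∙-comm u v = sum-cong-≋ (λ t → *-comm (u t) (v t))

∙-linearˡ : (u w v : Vector ℤ m) (e : ℤ) → (λ t → u t + e * w t) ∙ v ≡ u ∙ v + e * (w ∙ v)
∙-linearˡ {m} u w v e = begin
    ∑[ t < m ] ((u t + e * w t) * v t)
  ≡⟨ sum-cong-≋ (λ t → distrib (u t) (w t) (v t) e) ⟩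
    ∑[ t < m ] (u t * v t + e * (w t * v t))
  ≡⟨ ∑-distrib-+ (λ t → u t * v t) (λ t → e * (w t * v t)) ⟩
    u ∙ v + ∑[ t < m ] (e * (w t * v t))
  ≡⟨ cong (_+_ (u ∙ v)) (sym (*-distribˡ-sum e (λ t → w t * v t))) ⟩
    u ∙ v + e * (w ∙ v) ∎
  where
  open ≡-Reasoning
  distrib : ∀ p q r e → (p + e * q) * r ≡ p * r + e * (q * r)
  distrib = solve-∀

combination : (Fin n → ℤ) → (Fin n → Vector ℤ m) → Vector ℤ m
combination {n} x r t = ∑[ i < n ] (x i * r i t)

∙-combination : (u : Vector ℤ m) (x : Fin n → ℤ) (r : Fin n → Vector ℤ m) →
                u ∙ combination x r ≡ ∑[ i < n ] (x i * (u ∙ r i))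
∙-combination {m} {n} u x r = begin
    ∑[ t < m ] (u t * ∑[ i < n ] (x i * r i t))
  ≡⟨ sum-cong-≋ (λ t → *-distribˡ-sum (u t) (λ i → x i * r i t)) ⟩
    ∑[ t < m ] ∑[ i < n ] (u t * (x i * r i t))
  ≡⟨ ∑-comm (λ t i → u t * (x i * r i t)) ⟩
    ∑[ i < n ] ∑[ t < m ] (u t * (x i * r i t))
  ≡⟨ sum-cong-≋ (λ i → trans (sum-cong-≋ (λ t → swap (u t) (x i) (r i t)))
                              (sym (*-distribˡ-sum (x i) (λ t → u t * r i t)))) ⟩
    ∑[ i < n ] (x i * (u ∙ r i)) ∎
  where
  open ≡-Reasoning
  swap : ∀ a b c → a * (b * c) ≡ b * (a * c)
  swap = solve-∀

Independent : (Fin n → Vector ℤ m) → Set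
Independent r = ∀ x → (∀ t → combination x r t ≡ 0ℤ) → ∀ i → x i ≡ 0ℤ

square-nonNeg : ∀ i → 0ℤ ℤ.≤ i * i
square-nonNeg (+ zero) = +≤+ z≤n
square-nonNeg +[1+ _ ] = +≤+ z≤n
square-nonNeg -[1+ _ ] = +≤+ z≤n

square≡0 : ∀ i → i * i ≡ 0ℤ → i ≡ 0ℤ
square≡0 i eq = [ id , id ]′ (i*j≡0⇒i≡0∨j≡0 i eq)

nonNeg+nonNeg≡0 : ∀ {i j} → 0ℤ ℤ.≤ i → 0ℤ ℤ.≤ j → i + j ≡ 0ℤ → i ≡ 0ℤ × j ≡ 0ℤ
nonNeg+nonNeg≡0 {+ zero}  {+ zero}  _ _ _  = refl , refl
nonNeg+nonNeg≡0 {+ zero}  {+ suc _} _ _ ()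
nonNeg+nonNeg≡0 {+ suc _} {+ _}     _ _ ()

∑-nonNeg : (f : Vector ℤ m) → (∀ t → 0ℤ ℤ.≤ f t) → 0ℤ ℤ.≤ sum f
∑-nonNeg {zero}  f f≥0 = +≤+ z≤n
∑-nonNeg {suc m} f f≥0 = +-mono-≤ (f≥0 zero) (∑-nonNeg (f ∘ suc) (f≥0 ∘ suc))

∑-nonNeg≡0 : (f : Vector ℤ m) → (∀ t → 0ℤ ℤ.≤ f t) → sum f ≡ 0ℤ → ∀ t → f t ≡ 0ℤ
∑-nonNeg≡0 {suc m} f f≥0 ∑f≡0 t
  with nonNeg+nonNeg≡0 (f≥0 zero) (∑-nonNeg (f ∘ suc) (f≥0 ∘ suc)) ∑f≡0
∑-nonNeg≡0 {suc m} f f≥0 ∑f≡0 zero    | f₀≡0 , _   = f₀≡0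
∑-nonNeg≡0 {suc m} f f≥0 ∑f≡0 (suc t) | _   , rest = ∑-nonNeg≡0 (f ∘ suc) (f≥0 ∘ suc) rest t

∙-self≡0 : (u : Vector ℤ m) → u ∙ u ≡ 0ℤ → ∀ t → u t ≡ 0ℤ
∙-self≡0 u u∙u≡0 t = square≡0 (u t) (∑-nonNeg≡0 (λ t → u t * u t) (square-nonNeg ∘ u) u∙u≡0 t)

form : (Fin n → Fin n → ℤ) → (Fin n → ℤ) → ℤ
form {n} M y = ∑[ i < n ] ∑[ j < n ] (y i * y j * M i j)

form-cong : {M M′ : Fin n → Fin n → ℤ} → (∀ i j → M i j ≡ M′ i j) →
            (y : Fin n → ℤ) → form M y ≡ form M′ y
form-cong M≐M′ y = sum-cong-≋ (λ i → sum-cong-≋ (λ j → cong (y i * y j *_) (M≐M′ i j)))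

gramForm : (Fin n → Vector ℤ m) → (Fin n → ℤ) → ℤ
gramForm r = form (λ i j → r i ∙ r j)

gramForm-combination : (r : Fin n → Vector ℤ m) (y : Fin n → ℤ) →
                       gramForm r y ≡ combination y r ∙ combination y r
gramForm-combination {n} {m} r y = sym (begin
    ∑[ t < m ] (c t * c t)
  ≡⟨ sum-cong-≋ (λ t → *-distribʳ-sum (c t) (λ i → y i * r i t)) ⟩
    ∑[ t < m ] ∑[ i < n ] (y i * r i t * c t)
  ≡⟨ sum-cong-≋ (λ t → sum-cong-≋ (λ i → *-distribˡ-sum (y i * r i t) (λ j → y j * r j t))) ⟩
    ∑[ t < m ] ∑[ i < n ] ∑[ j < n ] (y i * r i t * (y j * r j t))
  ≡⟨ ∑-comm (λ t i → ∑[ j < n ] (y i * r i t * (y j * r j t))) ⟩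
    ∑[ i < n ] ∑[ t < m ] ∑[ j < n ] (y i * r i t * (y j * r j t))
  ≡⟨ sum-cong-≋ (λ i → ∑-comm (λ t j → y i * r i t * (y j * r j t))) ⟩
    ∑[ i < n ] ∑[ j < n ] ∑[ t < m ] (y i * r i t * (y j * r j t))
  ≡⟨ sum-cong-≋ (λ i → sum-cong-≋ (λ j → sum-cong-≋ (λ t → regroup (y i) (y j) (r i t) (r j t)))) ⟩
    ∑[ i < n ] ∑[ j < n ] ∑[ t < m ] (y i * y j * (r i t * r j t))
  ≡⟨ sum-cong-≋ (λ i → sum-cong-≋ (λ j → sym (*-distribˡ-sum (y i * y j) (λ t → r i t * r j t)))) ⟩
    gramForm r y ∎)
  where
  open ≡-Reasoning
  c : Vector ℤ m
  c = combination y r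
  regroup : ∀ a b u v → a * u * (b * v) ≡ a * b * (u * v)
  regroup = solve-∀

gramForm≡0⇒≡0 : (r : Fin n → Vector ℤ m) → Independent r →
                (y : Fin n → ℤ) → gramForm r y ≡ 0ℤ → ∀ i → y i ≡ 0ℤ
gramForm≡0⇒≡0 r independent y form≡0 =
  independent y (∙-self≡0 (combination y r) (trans (sym (gramForm-combination r y)) form≡0))

δ : Fin n → Fin n → ℤ
δ a i = if does (a ≟ i) then 1ℤ else 0ℤ

δ-diag : (a : Fin n) → δ a a ≡ 1ℤ
δ-diag a = cong (if_then 1ℤ else 0ℤ) (dec-true (a ≟ a) refl)

δ-off : {a b : Fin n} → a ≢ b → δ a b ≡ 0ℤ
δ-off {a = a} {b} a≢b = cong (if_then 1ℤ else 0ℤ) (dec-false (a ≟ b) a≢b)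

δ-sym : (a b : Fin n) → δ a b ≡ δ b a
δ-sym a b = cong (if_then 1ℤ else 0ℤ) (does-⇔ (mk⇔ sym sym) (a ≟ b) (b ≟ a))

δ-injective : {h : Fin k → Fin n} → Injective _≡_ _≡_ h → (a b : Fin k) → δ (h a) (h b) ≡ δ a b
δ-injective {h = h} h-inj a b with toSum (a ≟ b)
... | inj₁ refl = trans (δ-diag (h a)) (sym (δ-diag a))
... | inj₂ a≢b  = trans (δ-off (a≢b ∘ h-inj)) (sym (δ-off a≢b))

∑-δ : (a : Fin n) (f : Vector ℤ n) → ∑[ i < n ] (δ a i * f i) ≡ f a
∑-δ {suc n} zero f = begin
    1ℤ * f zero + ∑[ i < n ] (0ℤ * f (suc i))
  ≡⟨ cong₂ _+_ (*-identityˡ (f zero))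
               (trans (sum-cong-≋ (λ i → *-zeroˡ (f (suc i)))) (sum-replicate-zero n)) ⟩
    f zero + 0ℤ
  ≡⟨ +-identityʳ (f zero) ⟩
    f zero ∎
  where open ≡-Reasoning
∑-δ {suc n} (suc a) f = trans (cong₂ _+_ (*-zeroˡ (f zero)) (∑-δ a (f ∘ suc))) (+-identityˡ (f (suc a)))

independent-∘ : {r : Fin n → Vector ℤ m} {h : Fin k → Fin n} →
                Independent r → Injective _≡_ _≡_ h → Independent (r ∘ h)
independent-∘ {n} {m} {k} {r} {h} independent h-inj x comb≡0 l = begin
    x l
  ≡⟨ sym (∑-δ l x) ⟩
    ∑[ l′ < k ] (δ l l′ * x l′)
  ≡⟨ sum-cong-≋ (λ l′ → trans (*-comm (δ l l′) (x l′)) (cong (x l′ *_) (δ-pulled l′))) ⟩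
    x′ (h l)
  ≡⟨ independent x′ (λ t → trans (x′-combination t) (comb≡0 t)) (h l) ⟩
    0ℤ ∎
  where
  open ≡-Reasoning
  x′ : Fin n → ℤ
  x′ i = ∑[ l < k ] (x l * δ (h l) i)

  δ-pulled : ∀ l′ → δ l l′ ≡ δ (h l′) (h l)
  δ-pulled l′ = trans (δ-sym l l′) (sym (δ-injective h-inj l′ l))

  x′-combination : ∀ t → combination x′ r t ≡ combination x (r ∘ h) t
  x′-combination t = begin
      ∑[ i < n ] (x′ i * r i t)
    ≡⟨ sum-cong-≋ (λ i → *-distribʳ-sum (r i t) (λ l → x l * δ (h l) i)) ⟩
      ∑[ i < n ] ∑[ l < k ] (x l * δ (h l) i * r i t)
    ≡⟨ ∑-comm (λ i l → x l * δ (h l) i * r i t) ⟩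
      ∑[ l < k ] ∑[ i < n ] (x l * δ (h l) i * r i t)
    ≡⟨ sum-cong-≋ (λ l → trans (sum-cong-≋ (λ i → *-assoc (x l) (δ (h l) i) (r i t)))
                                 (sym (*-distribˡ-sum (x l) (λ i → δ (h l) i * r i t)))) ⟩
      ∑[ l < k ] (x l * ∑[ i < n ] (δ (h l) i * r i t))
    ≡⟨ sum-cong-≋ (λ l → cong (x l *_) (∑-δ (h l) (λ i → r i t))) ⟩
      combination x (r ∘ h) t ∎

independent-dual : (r u : Fin n → Vector ℤ m) → (∀ i j → u i ∙ r j ≡ + 2 * δ i j) → Independent r
independent-dual {n} {m} r u dual x comb≡0 i = [ id , (λ ()) ]′ (i*j≡0⇒i≡0∨j≡0 (x i) (begin
    x i * + 2
  ≡⟨ sym (∑-δ i (λ j → x j * + 2)) ⟩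
    ∑[ j < n ] (δ i j * (x j * + 2))
  ≡⟨ sum-cong-≋ (λ j → trans (swap (δ i j) (x j)) (cong (x j *_) (sym (dual i j)))) ⟩
    ∑[ j < n ] (x j * (u i ∙ r j))
  ≡⟨ sym (∙-combination (u i) x r) ⟩
    u i ∙ combination x r
  ≡⟨ sum-cong-≋ (λ t → trans (cong (u i t *_) (comb≡0 t)) (*-zeroʳ (u i t))) ⟩
    ∑[ t < m ] 0ℤ
  ≡⟨ sum-replicate-zero m ⟩
    0ℤ ∎))
  where
  open ≡-Reasoning
  swap : ∀ d y → d * (y * + 2) ≡ y * (+ 2 * d)
  swap = solve-∀

module Shear (r : Fin n → Vector ℤ m) (c a : Fin n) (e : ℤ) where

  shear : Fin n → Vector ℤ m
  shear i t = r i t + δ c i * (e * r a t)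

  shear-at : ∀ t → shear c t ≡ r c t + e * r a t
  shear-at t = cong (_+_ (r c t)) (trans (cong (_* (e * r a t)) (δ-diag c)) (*-identityˡ (e * r a t)))

  shear-away : ∀ {i} → c ≢ i → ∀ t → shear i t ≡ r i t
  shear-away {i} c≢i t = trans (cong (λ z → r i t + z * (e * r a t)) (δ-off c≢i)) (+-identityʳ (r i t))

  independent-shear : c ≢ a → Independent r → Independent shear
  independent-shear c≢a independent x comb≡0 i = begin
      x i                      ≡⟨ sym (+-identityʳ (x i)) ⟩
      x i + 0ℤ                 ≡⟨ cong (_+_ (x i)) (sym (*-zeroʳ (δ a i))) ⟩
      x i + δ a i * (0ℤ * e)   ≡⟨ cong (λ z → x i + δ a i * (z * e)) (sym xc≡0) ⟩
      x′ i                     ≡⟨ x′≡0 i ⟩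
      0ℤ                       ∎
    where
    open ≡-Reasoning
    x′ : Fin n → ℤ
    x′ j = x j + δ a j * (x c * e)

    sheared : ∀ t → combination x shear t ≡ combination x r t + x c * (e * r a t)
    sheared t = trans (sum-cong-≋ (λ j → distrib (x j) (r j t) (δ c j) (e * r a t)))
                      (trans (∑-distrib-+ (λ j → x j * r j t) (λ j → δ c j * (x j * (e * r a t))))
                             (cong (_+_ (combination x r t)) (∑-δ c (λ j → x j * (e * r a t)))))
      where
      distrib : ∀ p q d w → p * (q + d * w) ≡ p * q + d * (p * w)
      distrib = solve-∀

    transferred : ∀ t → combination x′ r t ≡ combination x r t + x c * (e * r a t)
    transferred t = trans (sum-cong-≋ (λ j → distrib (x j) (r j t) (δ a j) (x c * e)))
                          (trans (∑-distrib-+ (λ j → x j * r j t) (λ j → δ a j * (x c * e * r j t)))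
                                 (cong (_+_ (combination x r t))
                                       (trans (∑-δ a (λ j → x c * e * r j t)) (*-assoc (x c) e (r a t)))))
      where
      distrib : ∀ p q d w → (p + d * w) * q ≡ p * q + d * (w * q)
      distrib = solve-∀

    x′≡0 : ∀ j → x′ j ≡ 0ℤ
    x′≡0 = independent x′ (λ t → trans (transferred t) (trans (sym (sheared t)) (comb≡0 t)))

    xc≡0 : x c ≡ 0ℤ
    xc≡0 = trans (sym (trans (cong (λ z → x c + z * (x c * e)) (δ-off (c≢a ∘ sym))) (+-identityʳ (x c))))
                 (x′≡0 c)

-- Basic moves

Adjacency : ℕ → Set
Adjacency n = Fin n → Fin n → Bool

xor-cancelˡ : ∀ b d → b xor (b xor d) ≡ d
xor-cancelˡ b d = trans (sym (xor-assoc b b d)) (cong (_xor d) (xor-same b))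

module _ (c a : Fin n) (A : Adjacency n) where

  φ-diag : φ c a A c c ≡ A c c
  φ-diag rewrite dec-true (c ≟ c) refl = refl

  φ-left : ∀ {y} → y ≢ c → φ c a A c y ≡ A a y xor A c y
  φ-left {y} y≢c rewrite dec-true (c ≟ c) refl | dec-false (y ≟ c) y≢c with A a y
  ... | true  = refl
  ... | false = refl

  φ-right : ∀ {x} → x ≢ c → φ c a A x c ≡ A a x xor A x c
  φ-right {x} x≢c rewrite dec-true (c ≟ c) refl | dec-false (x ≟ c) x≢c with A a x
  ... | true  = refl
  ... | false = refl

  φ-away : ∀ {x y} → x ≢ c → y ≢ c → φ c a A x y ≡ A x y
  φ-away {x} {y} x≢c y≢c rewrite dec-false (x ≟ c) x≢c | dec-false (y ≟ c) y≢c = refl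

module _ (c a : Fin n) {A : Adjacency n} where

  φ-symmetric : (∀ x y → A x y ≡ A y x) → ∀ x y → φ c a A x y ≡ φ c a A y x
  φ-symmetric A-sym x y with toSum (x ≟ c) | toSum (y ≟ c)
  ... | inj₁ refl | inj₁ refl = refl
  ... | inj₁ refl | inj₂ y≢c  =
    trans (φ-left c a A y≢c) (trans (cong (A a y xor_) (A-sym c y)) (sym (φ-right c a A y≢c)))
  ... | inj₂ x≢c  | inj₁ refl =
    trans (φ-right c a A x≢c) (trans (cong (A a x xor_) (A-sym x c)) (sym (φ-left c a A x≢c)))
  ... | inj₂ x≢c  | inj₂ y≢c  =
    trans (φ-away c a A x≢c y≢c) (trans (A-sym x y) (sym (φ-away c a A y≢c x≢c)))

  φ-irreflexive : (∀ x → A x x ≡ false) → ∀ x → φ c a A x x ≡ false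
  φ-irreflexive A-irrefl x with toSum (x ≟ c)
  ... | inj₁ refl = trans (φ-diag c a A) (A-irrefl c)
  ... | inj₂ x≢c  = trans (φ-away c a A x≢c x≢c) (A-irrefl x)

  φ-cong : {B : Adjacency n} → (∀ x y → A x y ≡ B x y) → ∀ x y → φ c a A x y ≡ φ c a B x y
  φ-cong {B} A≐B x y with toSum (x ≟ c) | toSum (y ≟ c)
  ... | inj₁ refl | inj₁ refl =
    trans (φ-diag c a A) (trans (A≐B c c) (sym (φ-diag c a B)))
  ... | inj₁ refl | inj₂ y≢c  =
    trans (φ-left c a A y≢c) (trans (cong₂ _xor_ (A≐B a y) (A≐B c y)) (sym (φ-left c a B y≢c)))
  ... | inj₂ x≢c  | inj₁ refl =
    trans (φ-right c a A x≢c) (trans (cong₂ _xor_ (A≐B a x) (A≐B x c)) (sym (φ-right c a B x≢c)))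
  ... | inj₂ x≢c  | inj₂ y≢c  =
    trans (φ-away c a A x≢c y≢c) (trans (A≐B x y) (sym (φ-away c a B x≢c y≢c)))

  φ-involutive : a ≢ c → ∀ x y → φ c a (φ c a A) x y ≡ A x y
  φ-involutive a≢c x y with toSum (x ≟ c) | toSum (y ≟ c)
  ... | inj₁ refl | inj₁ refl = trans (φ-diag c a (φ c a A)) (φ-diag c a A)
  ... | inj₁ refl | inj₂ y≢c  = begin
      φ c a (φ c a A) c y          ≡⟨ φ-left c a (φ c a A) y≢c ⟩
      φ c a A a y xor φ c a A c y  ≡⟨ cong₂ _xor_ (φ-away c a A a≢c y≢c) (φ-left c a A y≢c) ⟩
      A a y xor (A a y xor A c y)  ≡⟨ xor-cancelˡ (A a y) (A c y) ⟩
      A c y                        ∎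
    where open ≡-Reasoning
  ... | inj₂ x≢c  | inj₁ refl = begin
      φ c a (φ c a A) x c          ≡⟨ φ-right c a (φ c a A) x≢c ⟩
      φ c a A a x xor φ c a A x c  ≡⟨ cong₂ _xor_ (φ-away c a A a≢c x≢c) (φ-right c a A x≢c) ⟩
      A a x xor (A a x xor A x c)  ≡⟨ xor-cancelˡ (A a x) (A x c) ⟩
      A x c                        ∎
    where open ≡-Reasoning
  ... | inj₂ x≢c  | inj₂ y≢c  = trans (φ-away c a (φ c a A) x≢c y≢c) (φ-away c a A x≢c y≢c)

move : Graph n → Fin n → Fin n → Graph n
move G c a = record
  { adj    = φ c a (adj G)
  ; sym    = φ-symmetric c a (adj-sym G)
  ; irrefl = φ-irreflexive c a (adj-irrefl G)
  }

adjacent⇒distinct : (G : Graph n) {x y : Fin n} → adj G x y ≡ true → x ≢ y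
adjacent⇒distinct G {x} xy refl = case trans (sym xy) (adj-irrefl G x) of λ ()

basicMove-sym : {G H : Graph n} → BasicMove G H → BasicMove H G
basicMove-sym {G = G} {H} (c , a , ca , H≐φG) = c , a , Hca , G≐φH
  where
  a≢c : a ≢ c
  a≢c = adjacent⇒distinct G ca ∘ sym

  Hca : adj H c a ≡ true
  Hca = trans (H≐φG c a) (trans (φ-left c a (adj G) a≢c) (cong₂ _xor_ (adj-irrefl G a) ca))

  G≐φH : ∀ x y → adj G x y ≡ φ c a (adj H) x y
  G≐φH x y = sym (trans (φ-cong c a H≐φG x y) (φ-involutive c a a≢c x y))

-- An edge {c, y} deleted by the move is bypassed through a, and the edges {c, a}, {a, y} survive it.
connected-move : (G : Graph n) {c a : Fin n} → adj G c a ≡ true → Connected G → Connected (move G c a)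
connected-move G {c} {a} ca connected i j = kleisliStar id edge-walk (connected i j)
  where
  H : Graph _
  H = move G c a

  a≢c : a ≢ c
  a≢c = adjacent⇒distinct G ca ∘ sym

  Hca : adj H c a ≡ true
  Hca = trans (φ-left c a (adj G) a≢c) (cong₂ _xor_ (adj-irrefl G a) ca)

  from-c : ∀ {y} → y ≢ c → adj G c y ≡ true → Star (λ x y → adj H x y ≡ true) c y
  from-c {y} y≢c cy with adj G a y in ay
  ... | false = trans (φ-left c a (adj G) y≢c) (cong₂ _xor_ ay cy) ◅ ε
  ... | true  = Hca ◅ trans (φ-away c a (adj G) a≢c y≢c) ay ◅ ε

  edge-walk : ∀ {x y} → adj G x y ≡ true → Star (λ x y → adj H x y ≡ true) x y
  edge-walk {x} {y} xy with toSum (x ≟ c) | toSum (y ≟ c)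
  ... | inj₁ refl | inj₁ refl = ⊥-elim (adjacent⇒distinct G xy refl)
  ... | inj₁ refl | inj₂ y≢c  = from-c y≢c xy
  ... | inj₂ x≢c  | inj₁ refl =
    reverse (λ {u} {w} uw → trans (adj-sym H w u) uw) (from-c x≢c (trans (adj-sym G c x) xy))
  ... | inj₂ x≢c  | inj₂ y≢c  = trans (φ-away c a (adj G) x≢c y≢c) xy ◅ ε

-- Realisations

Unit : ℤ → Set
Unit z = z ≡ 1ℤ ⊎ z ≡ -1ℤ

unit-neg : ∀ {s} → Unit s → Unit (- s)
unit-neg (inj₁ refl) = inj₂ refl
unit-neg (inj₂ refl) = inj₁ refl

unit-* : ∀ {s q} → Unit s → Unit q → Unit (s * q)
unit-* (inj₁ refl) (inj₁ refl) = inj₁ refl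
unit-* (inj₁ refl) (inj₂ refl) = inj₂ refl
unit-* (inj₂ refl) (inj₁ refl) = inj₂ refl
unit-* (inj₂ refl) (inj₂ refl) = inj₁ refl

GramEntry : Bool → ℤ → Set
GramEntry true  z = Unit z
GramEntry false z = z ≡ 0ℤ

GramEntry? : ∀ b z → Dec (GramEntry b z)
GramEntry? true  z = (z ≟ℤ 1ℤ) ⊎-dec (z ≟ℤ -1ℤ)
GramEntry? false z = z ≟ℤ 0ℤ

record Realisation (A : Adjacency n) : Set where
  field
    dim         : ℕ
    root        : Fin n → Vector ℤ dim
    independent : Independent root
    norm        : ∀ i → root i ∙ root i ≡ + 2
    gram        : ∀ {i j} → i ≢ j → GramEntry (A i j) (root i ∙ root j)

Realisable : Graph n → Set
Realisable G = Realisation (adj G)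

_↪_ : Adjacency k → Adjacency n → Set
_↪_ {k} {n} L B = Σ[ f ∈ (Fin k → Fin n) ] (Injective _≡_ _≡_ f × (∀ i j → B (f i) (f j) ≡ L i j))

↪-trans : {L : Adjacency k} {K : Adjacency m} {A : Adjacency n} → L ↪ K → K ↪ A → L ↪ A
↪-trans (f , f-inj , f-adj) (g , g-inj , g-adj) =
  g ∘ f , f-inj ∘ g-inj , λ i j → trans (g-adj (f i) (f j)) (f-adj i j)

restrict : {L : Adjacency k} {A : Adjacency n} → L ↪ A → Realisation A → Realisation L
restrict (f , f-inj , f-adj) R = record
  { dim         = dim
  ; root        = root ∘ f
  ; independent = independent-∘ independent f-inj
  ; norm        = norm ∘ f
  ; gram        = λ {i} {j} i≢j → subst (λ b → GramEntry b _) (f-adj i j) (gram (i≢j ∘ f-inj))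
  }
  where open Realisation R

[]-injective : Injective _≡_ _≡_ ([] {A = Fin n})
[]-injective {x = ()}

∷-injective : {f : Fin k → Fin n} {x : Fin n} → (∀ i → f i ≢ x) →
              Injective _≡_ _≡_ f → Injective _≡_ _≡_ (x ∷ f)
∷-injective x∉f f-inj {zero}  {zero}  _     = refl
∷-injective x∉f f-inj {zero}  {suc j} x≡fj  = ⊥-elim (x∉f j (sym x≡fj))
∷-injective x∉f f-inj {suc i} {zero}  fi≡x  = ⊥-elim (x∉f i fi≡x)
∷-injective x∉f f-inj {suc i} {suc j} fi≡fj = cong suc (f-inj fi≡fj)

gram₃ : ℤ → ℤ → ℤ → Fin 3 → Fin 3 → ℤ
gram₃ s q w = (+ 2 ∷ s ∷ w ∷ []) ∷ (s ∷ + 2 ∷ q ∷ []) ∷ (w ∷ q ∷ + 2 ∷ []) ∷ []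

-- form (gram₃ s q w) (- s ∷ 1ℤ ∷ - q ∷ []) = 2 + 2 s q w
triangle-dichotomy : ∀ {s q w} → Unit s → Unit q → Unit w →
                     w ≡ s * q ⊎ form (gram₃ s q w) (- s ∷ 1ℤ ∷ - q ∷ []) ≡ 0ℤ
triangle-dichotomy (inj₁ refl) (inj₁ refl) (inj₁ refl) = inj₁ refl
triangle-dichotomy (inj₁ refl) (inj₁ refl) (inj₂ refl) = inj₂ refl
triangle-dichotomy (inj₁ refl) (inj₂ refl) (inj₁ refl) = inj₂ refl
triangle-dichotomy (inj₁ refl) (inj₂ refl) (inj₂ refl) = inj₁ refl
triangle-dichotomy (inj₂ refl) (inj₁ refl) (inj₁ refl) = inj₂ refl
triangle-dichotomy (inj₂ refl) (inj₁ refl) (inj₂ refl) = inj₁ refl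
triangle-dichotomy (inj₂ refl) (inj₂ refl) (inj₁ refl) = inj₁ refl
triangle-dichotomy (inj₂ refl) (inj₂ refl) (inj₂ refl) = inj₂ refl

module _ {G : Graph n} (R : Realisable G) where
  open Realisation R

  edge-unit : ∀ {i j} → adj G i j ≡ true → Unit (root i ∙ root j)
  edge-unit ij = subst (λ b → GramEntry b _) ij (gram (adjacent⇒distinct G ij))

  triangle-rule : ∀ {c a j} → adj G c a ≡ true → adj G a j ≡ true → adj G c j ≡ true →
                  root c ∙ root j ≡ (root c ∙ root a) * (root a ∙ root j)
  triangle-rule {c} {a} {j} ca aj cj with triangle-dichotomy (edge-unit ca) (edge-unit aj) (edge-unit cj)
  ... | inj₁ w≡sq   = w≡sq
  ... | inj₂ form≡0 =
    case gramForm≡0⇒≡0 (root ∘ h) (independent-∘ independent h-inj) y (trans (form-cong entries y) form≡0) (suc zero)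
    of λ ()
    where
    h : Fin 3 → Fin n
    h = c ∷ a ∷ j ∷ []

    h-inj : Injective _≡_ _≡_ h
    h-inj = ∷-injective (λ { zero → adjacent⇒distinct G ca ∘ sym ; (suc zero) → adjacent⇒distinct G cj ∘ sym })
              (∷-injective (λ { zero → adjacent⇒distinct G aj ∘ sym })
                (∷-injective (λ ()) []-injective))

    y : Fin 3 → ℤ
    y = - (root c ∙ root a) ∷ 1ℤ ∷ - (root a ∙ root j) ∷ []

    entries : ∀ i l → root (h i) ∙ root (h l) ≡
                      gram₃ (root c ∙ root a) (root a ∙ root j) (root c ∙ root j) i l
    entries zero             zero             = norm c
    entries zero             (suc zero)       = refl
    entries zero             (suc (suc zero)) = refl
    entries (suc zero)       zero             = ∙-comm (root a) (root c)
    entries (suc zero)       (suc zero)       = norm a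
    entries (suc zero)       (suc (suc zero)) = refl
    entries (suc (suc zero)) zero             = ∙-comm (root j) (root c)
    entries (suc (suc zero)) (suc zero)       = ∙-comm (root j) (root a)
    entries (suc (suc zero)) (suc (suc zero)) = norm j

star : ∀ k → Adjacency (suc k)
star k zero    (suc _) = true
star k (suc _) zero    = true
star k _       _       = false

starGram : Vector ℤ 4 → Fin 5 → Fin 5 → ℤ
starGram s zero    zero    = + 2
starGram s zero    (suc j) = s j
starGram s (suc i) zero    = s i
starGram s (suc i) (suc j) = + 2 * δ i j

star-isotropic : ∀ {a b c d} → Unit a → Unit b → Unit c → Unit d →
                 form (starGram (a ∷ b ∷ c ∷ d ∷ [])) (+ 2 ∷ - a ∷ - b ∷ - c ∷ - d ∷ []) ≡ 0ℤ
star-isotropic (inj₁ refl) (inj₁ refl) (inj₁ refl) (inj₁ refl) = refl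
star-isotropic (inj₁ refl) (inj₁ refl) (inj₁ refl) (inj₂ refl) = refl
star-isotropic (inj₁ refl) (inj₁ refl) (inj₂ refl) (inj₁ refl) = refl
star-isotropic (inj₁ refl) (inj₁ refl) (inj₂ refl) (inj₂ refl) = refl
star-isotropic (inj₁ refl) (inj₂ refl) (inj₁ refl) (inj₁ refl) = refl
star-isotropic (inj₁ refl) (inj₂ refl) (inj₁ refl) (inj₂ refl) = refl
star-isotropic (inj₁ refl) (inj₂ refl) (inj₂ refl) (inj₁ refl) = refl
star-isotropic (inj₁ refl) (inj₂ refl) (inj₂ refl) (inj₂ refl) = refl
star-isotropic (inj₂ refl) (inj₁ refl) (inj₁ refl) (inj₁ refl) = refl
star-isotropic (inj₂ refl) (inj₁ refl) (inj₁ refl) (inj₂ refl) = refl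
star-isotropic (inj₂ refl) (inj₁ refl) (inj₂ refl) (inj₁ refl) = refl
star-isotropic (inj₂ refl) (inj₁ refl) (inj₂ refl) (inj₂ refl) = refl
star-isotropic (inj₂ refl) (inj₂ refl) (inj₁ refl) (inj₁ refl) = refl
star-isotropic (inj₂ refl) (inj₂ refl) (inj₁ refl) (inj₂ refl) = refl
star-isotropic (inj₂ refl) (inj₂ refl) (inj₂ refl) (inj₁ refl) = refl
star-isotropic (inj₂ refl) (inj₂ refl) (inj₂ refl) (inj₂ refl) = refl

star-unrealisable : ¬ Realisation (star 4)
star-unrealisable R = case gramForm≡0⇒≡0 root independent y form≡0 zero of λ ()
  where
  open Realisation R
  s : Vector ℤ 4
  s j = root zero ∙ root (suc j)

  unit : ∀ j → Unit (s j)
  unit j = gram {zero} {suc j} λ ()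

  y : Fin 5 → ℤ
  y = + 2 ∷ - s (# 0) ∷ - s (# 1) ∷ - s (# 2) ∷ - s (# 3) ∷ []

  entries : ∀ i j → root i ∙ root j ≡ starGram s i j
  entries zero    zero    = norm zero
  entries zero    (suc j) = refl
  entries (suc i) zero    = ∙-comm (root (suc i)) (root zero)
  entries (suc i) (suc j) with toSum (i ≟ j)
  ... | inj₁ refl = trans (norm (suc i)) (cong (+ 2 *_) (sym (δ-diag i)))
  ... | inj₂ i≢j  = trans (gram (i≢j ∘ suc-injective)) (cong (+ 2 *_) (sym (δ-off i≢j)))

  form≡0 : gramForm root y ≡ 0ℤ
  form≡0 = trans (form-cong entries y) (star-isotropic (unit (# 0)) (unit (# 1)) (unit (# 2)) (unit (# 3)))

reflected-norm : ∀ {s} → Unit s → (+ 2 + - s * s) + - s * (s + - s * + 2) ≡ + 2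
reflected-norm (inj₁ refl) = refl
reflected-norm (inj₂ refl) = refl

reflected-pivot : ∀ {s} → Unit s → Unit (s + - s * + 2)
reflected-pivot (inj₁ refl) = inj₂ refl
reflected-pivot (inj₂ refl) = inj₁ refl

reflected-entry : ∀ {α β s q w} → Unit s → GramEntry α q → GramEntry β w →
                  (α ≡ true → β ≡ true → w ≡ s * q) → GramEntry (α xor β) (w + - s * q)
reflected-entry {false} {β} {s} {w = w} _ refl w-entry _ =
  subst (GramEntry β) (sym (trans (cong (_+_ w) (*-zeroʳ (- s))) (+-identityʳ w))) w-entry
reflected-entry {true} {false} {s} {q} s-unit q-unit refl _ =
  subst Unit (sym (+-identityˡ (- s * q))) (unit-* (unit-neg s-unit) q-unit)
reflected-entry {true} {true} {s} {q} _ _ _ triangle = trans (cong (_+ - s * q) (triangle refl refl)) (cancel s q)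
  where
  cancel : ∀ s q → s * q + - s * q ≡ 0ℤ
  cancel = solve-∀

realisation-move : {G H : Graph n} → BasicMove G H → Realisable G → Realisable H
realisation-move {n} {G} {H} (c , a , ca , H≐φG) R = record
  { dim         = dim
  ; root        = shear
  ; independent = independent-shear (adjacent⇒distinct G ca) independent
  ; norm        = norm′
  ; gram        = gram′
  }
  where
  open Realisation R
  s : ℤ
  s = root c ∙ root a

  open Shear root c a (- s)

  shear-c∙ : ∀ v → shear c ∙ v ≡ root c ∙ v + - s * (root a ∙ v)
  shear-c∙ v = trans (sum-cong-≋ (λ t → cong (_* v t) (shear-at t))) (∙-linearˡ (root c) (root a) v (- s))

  ∙shear-c : ∀ i → root i ∙ shear c ≡ root c ∙ root i + - s * (root a ∙ root i)
  ∙shear-c i = trans (∙-comm (root i) (shear c)) (shear-c∙ (root i))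

  shear-away∙ : ∀ {i} → i ≢ c → ∀ v → shear i ∙ v ≡ root i ∙ v
  shear-away∙ i≢c v = sum-cong-≋ (λ t → cong (_* v t) (shear-away (i≢c ∘ sym) t))

  unchanged : ∀ {i j} → i ≢ c → j ≢ c → shear i ∙ shear j ≡ root i ∙ root j
  unchanged {i} {j} i≢c j≢c =
    trans (shear-away∙ i≢c (shear j))
          (trans (∙-comm (root i) (shear j)) (trans (shear-away∙ j≢c (root i)) (∙-comm (root j) (root i))))

  H-left : ∀ {j} → j ≢ c → adj H c j ≡ adj G a j xor adj G c j
  H-left j≢c = trans (H≐φG c _) (φ-left c a (adj G) j≢c)

  H-away : ∀ {i j} → i ≢ c → j ≢ c → adj H i j ≡ adj G i j
  H-away i≢c j≢c = trans (H≐φG _ _) (φ-away c a (adj G) i≢c j≢c)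

  row : ∀ {j} → j ≢ c → GramEntry (adj H c j) (shear c ∙ shear j)
  row {j} j≢c with toSum (j ≟ a)
  ... | inj₁ refl = subst₂ GramEntry (sym (trans (H-left j≢c) (cong₂ _xor_ (adj-irrefl G a) ca)))
                                     (sym value) (reflected-pivot (edge-unit {G = G} R ca))
    where
    value : shear c ∙ shear a ≡ s + - s * + 2
    value = trans (∙-comm (shear c) (shear a))
                  (trans (shear-away∙ j≢c (shear c)) (trans (∙shear-c a) (cong (λ z → s + - s * z) (norm a))))
  ... | inj₂ j≢a  =
    subst₂ GramEntry (sym (H-left j≢c))
                     (sym (trans (∙-comm (shear c) (shear j)) (trans (shear-away∙ j≢c (shear c)) (∙shear-c j))))
                     (reflected-entry (edge-unit {G = G} R ca) (gram (j≢a ∘ sym)) (gram (j≢c ∘ sym))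
                                      (triangle-rule {G = G} R ca))

  norm′ : ∀ i → shear i ∙ shear i ≡ + 2
  norm′ i with toSum (i ≟ c)
  ... | inj₂ i≢c  = trans (unchanged i≢c i≢c) (norm i)
  ... | inj₁ refl = begin
      shear c ∙ shear c
    ≡⟨ shear-c∙ (shear c) ⟩
      root c ∙ shear c + - s * (root a ∙ shear c)
    ≡⟨ cong₂ (λ p q → p + - s * q) (∙shear-c c) (∙shear-c a) ⟩
      (root c ∙ root c + - s * (root a ∙ root c)) + - s * (s + - s * (root a ∙ root a))
    ≡⟨ cong₂ (λ p q → (p + - s * q) + - s * (s + - s * (root a ∙ root a)))
             (norm c) (∙-comm (root a) (root c)) ⟩
      (+ 2 + - s * s) + - s * (s + - s * (root a ∙ root a))
    ≡⟨ cong (λ z → (+ 2 + - s * s) + - s * (s + - s * z)) (norm a) ⟩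
      (+ 2 + - s * s) + - s * (s + - s * + 2)
    ≡⟨ reflected-norm (edge-unit {G = G} R ca) ⟩
      + 2 ∎
    where open ≡-Reasoning

  gram′ : ∀ {i j} → i ≢ j → GramEntry (adj H i j) (shear i ∙ shear j)
  gram′ {i} {j} i≢j with toSum (i ≟ c) | toSum (j ≟ c)
  ... | inj₁ refl | inj₁ refl = ⊥-elim (i≢j refl)
  ... | inj₁ refl | inj₂ j≢c  = row j≢c
  ... | inj₂ i≢c  | inj₁ refl = subst₂ GramEntry (adj-sym H c i) (∙-comm (shear c) (shear i)) (row i≢c)
  ... | inj₂ i≢c  | inj₂ j≢c  =
    subst₂ GramEntry (sym (H-away i≢c j≢c)) (sym (unchanged i≢c j≢c)) (gram i≢j)

realisable-BM : {G H : Graph n} → BMEquivalent G H → Realisable H → Realisable G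
realisable-BM ε R = R
realisable-BM {G = G} (_◅_ {j = K} (fwd G→K) K≈H) R =
  realisation-move {G = K} {G} (basicMove-sym {G = G} {K} G→K) (realisable-BM K≈H R)
realisable-BM {G = G} (_◅_ {j = K} (bwd K→G) K≈H) R =
  realisation-move {G = K} {G} K→G (realisable-BM K≈H R)

-- Dynkin graphs are realisable

extend : Subset k → Adjacency k → Adjacency (suc k)
extend p K zero    zero    = false
extend p K zero    (suc j) = lookup p j
extend p K (suc i) zero    = lookup p i
extend p K (suc i) (suc j) = K i j

-- Only the root of vertex zero has a nonzero anchor coordinate, so a new leaf at vertex zero
-- is realised by e_new − e_anchor.
record Anchored (K : Adjacency (suc k)) : Set where
  field
    realisation : Realisation K
  open Realisation realisation public
  field
    anchor   : Fin dim
    anchored : ∀ i → root i anchor ≡ δ zero i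

anchored-resp : {K K′ : Adjacency (suc k)} → (∀ i j → K i j ≡ K′ i j) → Anchored K → Anchored K′
anchored-resp K≐K′ 𝒜 = record
  { realisation = restrict (id , id , K≐K′) realisation
  ; anchor      = anchor
  ; anchored    = anchored
  }
  where open Anchored 𝒜

extend-leaf : {K : Adjacency (suc k)} → Anchored K → Anchored (extend ⁅ zero ⁆ K)
extend-leaf {k} {K} 𝒜 = record
  { realisation = record
    { dim         = suc dim
    ; root        = root′
    ; independent = independent′
    ; norm        = norm′
    ; gram        = gram′
    }
  ; anchor      = zero
  ; anchored    = λ { zero → refl ; (suc i) → refl }
  }
  where
  open Anchored 𝒜

  new : Vector ℤ (suc dim)
  new = 1ℤ ∷ (λ t → - δ anchor t)

  root′ : Fin (suc (suc k)) → Vector ℤ (suc dim)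
  root′ = new ∷ (λ i → 0ℤ ∷ root i)

  shifted∙shifted : (u v : Vector ℤ dim) → (0ℤ ∷ u) ∙ (0ℤ ∷ v) ≡ u ∙ v
  shifted∙shifted u v = +-identityˡ (u ∙ v)

  new∙new : new ∙ new ≡ + 2
  new∙new = cong (_+_ 1ℤ) (begin
      ∑[ t < dim ] (- δ anchor t * - δ anchor t)  ≡⟨ sum-cong-≋ (λ t → neg-square (δ anchor t)) ⟩
      ∑[ t < dim ] (δ anchor t * δ anchor t)      ≡⟨ ∑-δ anchor (δ anchor) ⟩
      δ anchor anchor                             ≡⟨ δ-diag anchor ⟩
      1ℤ                                          ∎)
    where
    open ≡-Reasoning
    neg-square : ∀ z → - z * - z ≡ z * z
    neg-square = solve-∀

  new∙shifted : ∀ i → new ∙ (0ℤ ∷ root i) ≡ -1ℤ * δ zero i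
  new∙shifted i = trans (+-identityˡ _) (begin
      ∑[ t < dim ] (- δ anchor t * root i t)
    ≡⟨ sum-cong-≋ (λ t → pull (δ anchor t) (root i t)) ⟩
      ∑[ t < dim ] (-1ℤ * (δ anchor t * root i t))
    ≡⟨ sym (*-distribˡ-sum -1ℤ (λ t → δ anchor t * root i t)) ⟩
      -1ℤ * ∑[ t < dim ] (δ anchor t * root i t)
    ≡⟨ cong (-1ℤ *_) (trans (∑-δ anchor (root i)) (anchored i)) ⟩
      -1ℤ * δ zero i ∎)
    where
    open ≡-Reasoning
    pull : ∀ d z → - d * z ≡ -1ℤ * (d * z)
    pull = solve-∀

  leaf-entry : ∀ j → GramEntry (lookup ⁅ zero ⁆ j) (-1ℤ * δ zero j)
  leaf-entry zero    = inj₂ refl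
  leaf-entry (suc j) = subst (λ b → GramEntry b 0ℤ) (sym (lookup-replicate j false)) refl

  norm′ : ∀ i → root′ i ∙ root′ i ≡ + 2
  norm′ zero    = new∙new
  norm′ (suc i) = trans (shifted∙shifted (root i) (root i)) (norm i)

  gram′ : ∀ {i j} → i ≢ j → GramEntry (extend ⁅ zero ⁆ K i j) (root′ i ∙ root′ j)
  gram′ {zero}  {zero}  0≢0 = ⊥-elim (0≢0 refl)
  gram′ {zero}  {suc j} _   = subst (GramEntry _) (sym (new∙shifted j)) (leaf-entry j)
  gram′ {suc i} {zero}  _   =
    subst (GramEntry _) (trans (sym (new∙shifted i)) (∙-comm new (0ℤ ∷ root i))) (leaf-entry i)
  gram′ {suc i} {suc j} i≢j =
    subst (GramEntry _) (sym (shifted∙shifted (root i) (root j))) (gram (i≢j ∘ cong suc))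

  independent′ : Independent root′
  independent′ x comb≡0 = x≡0
    where
    x₀≡0 : x zero ≡ 0ℤ
    x₀≡0 = trans (sym first-coordinate) (comb≡0 zero)
      where
      first-coordinate : combination x root′ zero ≡ x zero
      first-coordinate = trans (cong₂ _+_ (*-identityʳ (x zero))
                                          (trans (sum-cong-≋ (λ i → *-zeroʳ (x (suc i)))) (sum-replicate-zero (suc k))))
                               (+-identityʳ (x zero))

    x≡0 : ∀ i → x i ≡ 0ℤ
    x≡0 zero    = x₀≡0
    x≡0 (suc i) = independent (x ∘ suc) (λ t → trans (sym (later-coordinate t)) (comb≡0 (suc t))) i
      where
      later-coordinate : ∀ t → combination x root′ (suc t) ≡ combination (x ∘ suc) root t
      later-coordinate t =
        trans (cong (λ z → z * - δ anchor t + combination (x ∘ suc) root t) x₀≡0) (+-identityˡ _)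

Certificate : Adjacency n → (r u : Fin n → Vector ℤ m) → Set
Certificate K r u = (∀ i → r i ∙ r i ≡ + 2)
                  × (∀ i j → i ≢ j → GramEntry (K i j) (r i ∙ r j))
                  × (∀ i j → u i ∙ r j ≡ + 2 * δ i j)

certificate? : (K : Adjacency n) (r u : Fin n → Vector ℤ m) → Dec (Certificate K r u)
certificate? K r u = all? (λ i → r i ∙ r i ≟ℤ + 2)
              ×-dec all? (λ i → all? λ j → ¬? (i ≟ j) →-dec GramEntry? (K i j) (r i ∙ r j))
              ×-dec all? (λ i → all? λ j → u i ∙ r j ≟ℤ + 2 * δ i j)

certified-realisation : (K : Adjacency n) (r u : Fin n → Vector ℤ m) →
                        {True (certificate? K r u)} → Realisation K
certified-realisation {m = m} K r u {certified} = record
  { dim = m ; root = r ; independent = independent-dual r u dual ; norm = norm ; gram = gram _ _ }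
  where
  norm = proj₁ (toWitness certified)
  gram = proj₁ (proj₂ (toWitness certified))
  dual = proj₂ (proj₂ (toWitness certified))

extend-A : ∀ k i j → extend ⁅ zero ⁆ (dynkinAdj (A k)) i j ≡ dynkinAdj (A (suc k)) i j
extend-A k zero          zero          = refl
extend-A k zero          (suc zero)    = refl
extend-A k zero          (suc (suc j)) = lookup-replicate j false
extend-A k (suc zero)    zero          = refl
extend-A k (suc (suc i)) zero          = lookup-replicate i false
extend-A k (suc i)       (suc j)       = refl

extend-D : ∀ k i j → extend ⁅ zero ⁆ (dynkinAdj (D k)) i j ≡ dynkinAdj (D (suc k)) i j
extend-D k zero          zero          = refl
extend-D k zero          (suc zero)    = refl
extend-D k zero          (suc (suc j)) = trans (lookup-replicate j false) (sym (∧-zeroʳ _))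
extend-D k (suc zero)    zero          = refl
extend-D k (suc (suc i)) zero          =
  trans (lookup-replicate i false) (sym (trans (∨-identityʳ _) (∧-zeroʳ _)))
extend-D k (suc i)       (suc j)       = refl

A-anchored : ∀ k → Anchored (dynkinAdj (A k))
A-anchored zero    = record
  { realisation = certified-realisation (dynkinAdj (A 0)) r r
  ; anchor      = zero
  ; anchored    = λ { zero → refl }
  }
  where
  r : Fin 1 → Vector ℤ 2
  r = (1ℤ ∷ -1ℤ ∷ []) ∷ []
A-anchored (suc k) = anchored-resp (extend-A k) (extend-leaf (A-anchored k))

fork-anchored : Anchored (star 2)
fork-anchored = record
  { realisation = certified-realisation (star 2) r u
  ; anchor      = zero
  ; anchored    = λ { zero → refl ; (suc zero) → refl ; (suc (suc zero)) → refl }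
  }
  where
  r u : Fin 3 → Vector ℤ 3
  r = (1ℤ ∷ -1ℤ ∷ 0ℤ ∷ []) ∷ (0ℤ ∷ 1ℤ ∷ -1ℤ ∷ []) ∷ (0ℤ ∷ 1ℤ ∷ 1ℤ ∷ []) ∷ []
  u = (+ 2 ∷ 0ℤ ∷ 0ℤ ∷ []) ∷ (1ℤ ∷ 1ℤ ∷ -1ℤ ∷ []) ∷ (1ℤ ∷ 1ℤ ∷ 1ℤ ∷ []) ∷ []

extend-fork : ∀ i j → extend ⁅ zero ⁆ (star 2) i j ≡ dynkinAdj (D 0) i j
extend-fork =
  toWitness {a? = all? λ i → all? λ j → extend ⁅ zero ⁆ (star 2) i j ≟ᵇ dynkinAdj (D 0) i j} _

D-anchored : ∀ k → Anchored (dynkinAdj (D k))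
D-anchored zero    = anchored-resp extend-fork (extend-leaf fork-anchored)
D-anchored (suc k) = anchored-resp (extend-D k) (extend-leaf (D-anchored k))

isomorphic-embedding : (H : Graph n) (σ : Fin n ↔ Fin n) {K : Adjacency n} →
                       (∀ i j → adj H (Inverse.to σ i) (Inverse.to σ j) ≡ K i j) → adj H ↪ K
isomorphic-embedding H σ H≅K =
  from , (λ {u} {w} eq → trans (sym (to∘from u)) (trans (cong to eq) (to∘from w))) ,
  λ u w → trans (sym (H≅K (from u) (from w))) (cong₂ (adj H) (to∘from u) (to∘from w))
  where
  open Inverse σ using (to; from) renaming (strictlyInverseˡ to to∘from)

dynkin-realisable : 9 ≤ n → (H : Graph n) → IsDynkin H → Realisable H
dynkin-realisable _   H (A k , σ , H≅) =
  restrict (isomorphic-embedding H σ H≅) (Anchored.realisation (A-anchored k))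
dynkin-realisable _   H (D k , σ , H≅) =
  restrict (isomorphic-embedding H σ H≅) (Anchored.realisation (D-anchored k))
dynkin-realisable 9≤6 H (E6 , _)       = ⊥-elim (from-no (9 ≤? 6) 9≤6)
dynkin-realisable 9≤7 H (E7 , _)       = ⊥-elim (from-no (9 ≤? 7) 9≤7)
dynkin-realisable 9≤8 H (E8 , _)       = ⊥-elim (from-no (9 ≤? 8) 9≤8)

-- Growing an induced E₆

Occurs : ℕ → Adjacency k → Set
Occurs n L = Σ[ G ∈ Graph n ] (Realisable G × Connected G × L ↪ adj G)

occurs-restrict : {L : Adjacency k} {K : Adjacency t} → L ↪ K → Occurs n K → Occurs n L
occurs-restrict {K = K} L↪K (G , R , connected , K↪G) = G , R , connected , ↪-trans {K = K} {adj G} L↪K K↪G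

star-never-occurs : ¬ Occurs n (star 4)
star-never-occurs (G , R , _ , star↪G) = star-unrealisable (restrict {L = star 4} star↪G R)

toggle : Adjacency k → Subset k → Fin k → Subset k
toggle K p a = tabulate (λ x → K a x xor lookup p x)

PatternMove : Adjacency k → Subset k → Subset k → Set
PatternMove K p q = Σ[ a ∈ Fin _ ] (lookup p a ≡ true × q ≡ toggle K p a)

occurs-step : {K : Adjacency k} {p q : Subset k} → PatternMove K p q →
              Occurs n (extend p K) → Occurs n (extend q K)
occurs-step {K = K} {p} (a , a∈p , refl) (G , R , connected , f , f-inj , f-adj) =
  move G v w ,
  realisation-move {G = G} {move G v w} (v , w , vw , λ _ _ → refl) R ,
  connected-move G vw connected ,
  f , f-inj , adj′
  where
  v w : Fin _
  v = f zero
  w = f (suc a)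

  vw : adj G v w ≡ true
  vw = trans (f-adj zero (suc a)) a∈p

  away : ∀ x → f (suc x) ≢ v
  away x eq = case f-inj eq of λ ()

  adj′ : ∀ i j → φ v w (adj G) (f i) (f j) ≡ extend (toggle K p a) K i j
  adj′ zero    zero    = trans (φ-diag v w (adj G)) (f-adj zero zero)
  adj′ zero    (suc x) = trans (φ-left v w (adj G) (away x))
                               (trans (cong₂ _xor_ (f-adj (suc a) (suc x)) (f-adj zero (suc x)))
                                      (sym (lookup∘tabulate (λ x → K a x xor lookup p x) x)))
  adj′ (suc x) zero    = trans (φ-right v w (adj G) (away x))
                               (trans (cong₂ _xor_ (f-adj (suc a) (suc x)) (f-adj (suc x) zero))
                                      (sym (lookup∘tabulate (λ x → K a x xor lookup p x) x)))
  adj′ (suc x) (suc y) = trans (φ-away v w (adj G) (away x) (away y)) (f-adj (suc x) (suc y))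

occurs-reach : {K : Adjacency k} {p q : Subset k} → Star (PatternMove K) p q →
               Occurs n (extend p K) → Occurs n (extend q K)
occurs-reach ε             = id
occurs-reach (step ◅ rest) = occurs-reach rest ∘ occurs-step step

InImage : (Fin k → Fin n) → Fin n → Set
InImage h w = Σ[ x ∈ Fin _ ] h x ≡ w

leaves-image : (G : Graph n) (h : Fin k → Fin n) {u w : Fin n} → Star (λ x y → adj G x y ≡ true) u w →
               InImage h u → ¬ InImage h w →
               Σ[ x ∈ Fin k ] Σ[ v ∈ Fin n ] (¬ InImage h v × adj G (h x) v ≡ true)
leaves-image G h ε                     u∈h        w∉h = ⊥-elim (w∉h u∈h)
leaves-image G h (_◅_ {j = z} uz rest) (x , refl) w∉h with any? (λ y → h y ≟ z)
... | yes z∈h = leaves-image G h rest z∈h w∉h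
... | no  z∉h = x , z , z∉h , uz

occurs-grow : {K : Adjacency (suc k)} → suc k < n → Occurs n K →
              Σ[ p ∈ Subset (suc k) ] (Nonempty p × Occurs n (extend p K))
occurs-grow {k} {n} k<n (G , R , connected , h , h-inj , h-adj)
  with ¬∀⟶∃¬ n (InImage h) (λ w → any? (λ y → h y ≟ w)) not-onto
  where
  not-onto : ¬ (∀ w → InImage h w)
  not-onto onto = <⇒≱ k<n (injective⇒≤ {f = proj₁ ∘ onto} λ {u} {w} eq →
                              trans (sym (proj₂ (onto u))) (trans (cong h eq) (proj₂ (onto w))))
... | w , w∉h with leaves-image G h (connected (h zero) w) (zero , refl) w∉h
... | x , v , v∉h , xv =
  p , (x , lookup⇒[]= x p (trans (lookup∘tabulate (λ y → adj G v (h y)) x) (trans (adj-sym G v (h x)) xv))) ,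
  G , R , connected , v ∷ h , ∷-injective (λ y eq → v∉h (y , eq)) h-inj , adj′
  where
  p : Subset (suc k)
  p = tabulate (λ y → adj G v (h y))

  adj′ : ∀ i j → adj G ((v ∷ h) i) ((v ∷ h) j) ≡ extend p _ i j
  adj′ zero    zero    = adj-irrefl G v
  adj′ zero    (suc y) = sym (lookup∘tabulate (λ y → adj G v (h y)) y)
  adj′ (suc y) zero    = trans (adj-sym G (h y) v) (sym (lookup∘tabulate (λ y → adj G v (h y)) y))
  adj′ (suc y) (suc z) = h-adj y z

_∈ᵀ_ : Subset k → Vector (Subset k) t → Set
p ∈ᵀ T = Σ[ i ∈ Fin _ ] T i ≡ p

Wins : Adjacency k → Vector (Subset k) t → (Subset k → Fin k) → ℕ → Subset k → Set
Wins K T σ zero    p = p ∈ᵀ T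
Wins K T σ (suc d) p = p ∈ᵀ T ⊎ (lookup p (σ p) ≡ true × Wins K T σ d (toggle K p (σ p)))

wins? : (K : Adjacency k) (T : Vector (Subset k) t) (σ : Subset k → Fin k) (d : ℕ) → Decidable (Wins K T σ d)
wins? K T σ zero    p = any? (λ i → ≡-decᵛ _≟ᵇ_ (T i) p)
wins? K T σ (suc d) p =
  any? (λ i → ≡-decᵛ _≟ᵇ_ (T i) p) ⊎-dec ((lookup p (σ p) ≟ᵇ true) ×-dec wins? K T σ d _)

wins⇒reach : {K : Adjacency k} {T : Vector (Subset k) t} {σ : Subset k → Fin k} (d : ℕ) {p : Subset k} →
             Wins K T σ d p → Σ[ i ∈ Fin t ] Star (PatternMove K) p (T i)
wins⇒reach zero    (i , refl)           = i , ε
wins⇒reach (suc d) (inj₁ (i , refl))    = i , ε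
wins⇒reach (suc d) (inj₂ (σp∈p , wins)) =
  let i , path = wins⇒reach d wins in i , (_ , σp∈p , refl) ◅ path

∀-subset? : {P : Subset k → Set} → Decidable P → Dec (∀ p → P p)
∀-subset? P? = map′ (λ ∄¬P p → decidable-stable (P? p) (λ ¬Pp → ∄¬P (p , ¬Pp)))
                    (λ ∀P (p , ¬Pp) → ¬Pp (∀P p))
                    (¬? (anySubset? (¬? ∘ P?)))

-- A record rather than a Π-type, so that comparing types of certificates never unfolds Wins.
record Winning (K : Adjacency k) (T : Vector (Subset k) t) (σ : Subset k → Fin k) (d : ℕ) : Set where
  constructor winning
  field
    wins : ∀ p → Nonempty p → Wins K T σ d p

winning? : (K : Adjacency k) (T : Vector (Subset k) t) (σ : Subset k → Fin k) (d : ℕ) → Dec (Winning K T σ d)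
winning? K T σ d = map′ winning Winning.wins (∀-subset? (λ p → nonempty? p →-dec wins? K T σ d p))

occurs-target : (K : Adjacency (suc k)) (T : Vector (Subset (suc k)) t)
                (σ : Subset (suc k) → Fin (suc k)) (d : ℕ) → Winning K T σ d →
                suc k < n → Occurs n K → Σ[ i ∈ Fin t ] Occurs n (extend (T i) K)
occurs-target K T σ d (winning wins) k<n occurs =
  let p , p≢∅ , occurs′ = occurs-grow k<n occurs
      i , path          = wins⇒reach d (wins p p≢∅)
  in  i , occurs-reach path occurs′

code : Subset k → ℕ
code = foldr′ (λ b c → (if b then 1 else 0) ℕ.+ 2 ℕ.* c) 0

digit : ℕ → ℕ → ℕ
digit table zero    = table % 10
digit table (suc i) = digit (table / 10) i

-- The move played at pattern p is the decimal digit of the table in position code p,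
-- counted from the units digit.
strategy : ℕ → Subset (suc k) → Fin (suc k)
strategy {k} table p = digit table (code p) mod suc k

Embeds : Adjacency k → Adjacency n → (Fin k → Fin n) → Set
Embeds L B f = (∀ i j → f i ≡ f j → i ≡ j) × (∀ i j → B (f i) (f j) ≡ L i j)

embeds? : (L : Adjacency k) (B : Adjacency n) (f : Fin k → Fin n) → Dec (Embeds L B f)
embeds? L B f = all? (λ i → all? λ j → (f i ≟ f j) →-dec (i ≟ j))
          ×-dec all? (λ i → all? λ j → B (f i) (f j) ≟ᵇ L i j)

star⇒never-occurs : (K : Adjacency k) (f : Fin 5 → Fin k) → {True (embeds? (star 4) K f)} → ¬ Occurs n K
star⇒never-occurs K f {embeds} =
  star-never-occurs ∘ occurs-restrict {K = K} (f , (λ {i} {j} → f-inj i j) , f-adj)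
  where
  f-inj = proj₁ (toWitness embeds)
  f-adj = proj₂ (toWitness embeds)

E₆ : Adjacency 6
E₆ = dynkinAdj E6

-- E₇ and E₈, labelled so that each contains the previous one on its last vertices.
E₇ : Adjacency 7
E₇ = extend ⁅ zero ⁆ E₆

E₈ : Adjacency 8
E₈ = extend ⁅ zero ⁆ E₇

T₈ : Vector (Subset 8) 2
T₈ = (⁅ # 1 ⁆ ∪ ⁅ # 2 ⁆ ∪ ⁅ # 4 ⁆ ∪ ⁅ # 6 ⁆) ∷ (⁅ # 2 ⁆ ∪ ⁅ # 4 ⁆ ∪ ⁅ # 6 ⁆) ∷ []

σ₈ : Subset 8 → Fin 8
σ₈ = strategy 7474474774744746373773732727717776766767767667646767767667677677575775755757757775755757757557554744747744474444737737337772777746466465464664646365363665625655424214064040140433363333262261665554555554554544555555535555555544444444444444443333333322221100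

E₈-winning : Winning E₈ T₈ σ₈ 24
E₈-winning = toWitness {a? = winning? E₈ T₈ σ₈ 24} _

E₈-never-occurs : 8 < n → ¬ Occurs n E₈
E₈-never-occurs 8<n occurs =
  at-target (occurs-target E₈ T₈ σ₈ 24 E₈-winning 8<n occurs)
  where
  at-target : ¬ (Σ[ i ∈ Fin 2 ] Occurs _ (extend (T₈ i) E₈))
  at-target (zero , occurs′) =
    star⇒never-occurs (extend (T₈ zero) E₈) (# 5 ∷ # 0 ∷ # 4 ∷ # 6 ∷ # 8 ∷ []) occurs′
  at-target (suc zero , occurs′) =
    star⇒never-occurs (extend (T₈ (suc zero)) E₈) (# 5 ∷ # 0 ∷ # 4 ∷ # 6 ∷ # 8 ∷ []) occurs′

T₇ : Vector (Subset 7) 3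
T₇ = ⁅ # 0 ⁆ ∷ (⁅ # 0 ⁆ ∪ ⁅ # 1 ⁆ ∪ ⁅ # 3 ⁆ ∪ ⁅ # 5 ⁆) ∷ (⁅ # 1 ⁆ ∪ ⁅ # 3 ⁆ ∪ ⁅ # 5 ⁆) ∷ []

σ₇ : Subset 7 → Fin 7
σ₇ = strategy 33363336662266645556555666556665664466634446444633363333662266665553555352551504110300032222110544444443444444443332333321220100

E₇-winning : Winning E₇ T₇ σ₇ 13
E₇-winning = toWitness {a? = winning? E₇ T₇ σ₇ 13} _

E₇-never-occurs : 8 < n → ¬ Occurs n E₇
E₇-never-occurs 8<n occurs =
  at-target (occurs-target E₇ T₇ σ₇ 13 E₇-winning (≤-trans (m≤n+m 8 1) 8<n) occurs)
  where
  at-target : ¬ (Σ[ i ∈ Fin 3 ] Occurs _ (extend (T₇ i) E₇))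
  at-target (zero , occurs′) = E₈-never-occurs 8<n occurs′
  at-target (suc zero , occurs′) =
    star⇒never-occurs (extend (T₇ (suc zero)) E₇) (# 4 ∷ # 0 ∷ # 3 ∷ # 5 ∷ # 7 ∷ []) occurs′
  at-target (suc (suc zero) , occurs′) =
    star⇒never-occurs (extend (T₇ (suc (suc zero))) E₇) (# 4 ∷ # 0 ∷ # 3 ∷ # 5 ∷ # 7 ∷ []) occurs′

T₆ : Vector (Subset 6) 2
T₆ = ⁅ # 0 ⁆ ∷ (⁅ # 0 ⁆ ∪ ⁅ # 2 ⁆ ∪ ⁅ # 4 ⁆) ∷ []

σ₆ : Subset 6 → Fin 6
σ₆ = strategy 2525515345455454535235352522515542421403020211043332333321220100

E₆-winning : Winning E₆ T₆ σ₆ 16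
E₆-winning = toWitness {a? = winning? E₆ T₆ σ₆ 16} _

E₆-never-occurs : 8 < n → ¬ Occurs n E₆
E₆-never-occurs 8<n occurs =
  at-target (occurs-target E₆ T₆ σ₆ 16 E₆-winning (≤-trans (m≤n+m 7 2) 8<n) occurs)
  where
  at-target : ¬ (Σ[ i ∈ Fin 2 ] Occurs _ (extend (T₆ i) E₆))
  at-target (zero , occurs′) = E₇-never-occurs 8<n occurs′
  at-target (suc zero , occurs′) =
    star⇒never-occurs (extend (T₆ (suc zero)) E₆) (# 3 ∷ # 0 ∷ # 2 ∷ # 4 ∷ # 6 ∷ []) occurs′

proposition5p5 : (n : ℕ) (Γ : Graph n) → Connected Γ → HasInducedE6 Γ → 9 ≤ n →
    (H : Graph n) → IsDynkin H → ¬ BMEquivalent Γ H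
proposition5p5 n Γ connected E₆↪Γ 9≤n H dynkin Γ≈H =
  E₆-never-occurs 9≤n (Γ , realisable-BM Γ≈H (dynkin-realisable 9≤n H dynkin) , connected , E₆↪Γ)
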